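{- Let $\Gamma$ be a $0$-bend apRAC drawing of a graph $G$. Then $\Gamma$ does not contain a triangle $T$ (three vertices of $G$ pairwise joined by edges of $G$, drawn as a closed triangle) together with a vertex $u$ and three distinct vertices $v_1,v_2,v_3$, each adjacent to $u$ in $G$, such that $u$ lies in the interior of $T$ while $v_1,v_2,v_3$ lie outside $T$.
   Context: Graphs are finite and simple. A $0$-bend (straight-line) RAC drawing of a graph maps vertices to distinct points and edges to straight-line segments between their endpoints not passing through other vertices, such that any two crossing edges cross at a right angle. A $0$-bend apRAC drawing is a $0$-bend RAC drawing in which every edge involved in a crossing is axis-parallel (so every crossing is between a horizontal and a vertical edge). -}

module Defs where

open import Level using (Level; _⊔_) renaming (suc to lsuc)
open import Algebra.Bundles using (CommutativeRing)
open import Relation.Binary.Core using (Rel)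
open import Relation.Binary.Structures using (IsTotalOrder)
open import Relation.Nullary using (¬_)
open import Relation.Binary.PropositionalEquality using (_≡_)
open import Data.Product using (_×_; _,_; proj₁; proj₂; ∃; ∃-syntax)
open import Data.Sum using (_⊎_)
open import Data.Fin using (Fin)
open import Data.Nat using (ℕ)

-- Coordinate field: an arbitrary ordered field (ℝ is one instance).

record OrderedField (c ℓ₁ ℓ₂ : Level) : Set (lsuc (c ⊔ ℓ₁ ⊔ ℓ₂)) where
  field
    commutativeRing : CommutativeRing c ℓ₁
  open CommutativeRing commutativeRing public
  field
    _≤_          : Rel Carrier ℓ₂
    isTotalOrder : IsTotalOrder _≈_ _≤_
    +-mono-≤     : ∀ {a b} z → a ≤ b → (a + z) ≤ (b + z)
    *-nonneg     : ∀ {a b} → 0# ≤ a → 0# ≤ b → 0# ≤ (a * b)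
    0≉1          : ¬ (0# ≈ 1#)
    inverse      : ∀ a → ¬ (a ≈ 0#) → ∃ λ b → (a * b) ≈ 1#

  _<_ : Rel Carrier (ℓ₁ ⊔ ℓ₂)
  a < b = (a ≤ b) × ¬ (a ≈ b)

record SimpleGraph (n : ℕ) : Set₁ where
  field
    Adj     : Fin n → Fin n → Set
    sym     : ∀ {a b} → Adj a b → Adj b a
    irrefl  : ∀ {a} → ¬ Adj a a

module Geometry {c ℓ₁ ℓ₂} (F : OrderedField c ℓ₁ ℓ₂) where
  open OrderedField F

  Point : Set c
  Point = Carrier × Carrier

  x : Point → Carrier
  x = proj₁

  y : Point → Carrier
  y = proj₂

  _≈P_ : Point → Point → Set ℓ₁
  p ≈P q = (x p ≈ x q) × (y p ≈ y q)

  OnSegment : Point → Point → Point → Set (c ⊔ ℓ₁ ⊔ ℓ₂)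
  OnSegment p a b = ∃[ t ] ((0# ≤ t) × (t ≤ 1#) ×
    ((x p ≈ (x a + t * (x b - x a))) × (y p ≈ (y a + t * (y b - y a)))))

  SegmentsMeet : Point → Point → Point → Point → Set (c ⊔ ℓ₁ ⊔ ℓ₂)
  SegmentsMeet a b c' d = ∃[ p ] (OnSegment p a b × OnSegment p c' d)

  Horizontal : Point → Point → Set ℓ₁
  Horizontal a b = y a ≈ y b

  Vertical : Point → Point → Set ℓ₁
  Vertical a b = x a ≈ x b

  InInterior : Point → Point → Point → Point → Set (c ⊔ ℓ₁ ⊔ ℓ₂)
  InInterior p a b c' = ∃[ l₁ ] ∃[ l₂ ] ∃[ l₃ ]
    ((0# < l₁) × (0# < l₂) × (0# < l₃) × ((l₁ + l₂ + l₃) ≈ 1#) ×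
     (x p ≈ (l₁ * x a + l₂ * x b + l₃ * x c')) ×
     (y p ≈ (l₁ * y a + l₂ * y b + l₃ * y c')))

  InClosedTriangle : Point → Point → Point → Point → Set (c ⊔ ℓ₁ ⊔ ℓ₂)
  InClosedTriangle p a b c' = ∃[ l₁ ] ∃[ l₂ ] ∃[ l₃ ]
    ((0# ≤ l₁) × (0# ≤ l₂) × (0# ≤ l₃) × ((l₁ + l₂ + l₃) ≈ 1#) ×
     (x p ≈ (l₁ * x a + l₂ * x b + l₃ * x c')) ×
     (y p ≈ (l₁ * y a + l₂ * y b + l₃ * y c')))

  Outside : Point → Point → Point → Point → Set (c ⊔ ℓ₁ ⊔ ℓ₂)
  Outside p a b c' = ¬ InClosedTriangle p a b c'

  module _ {n : ℕ} (G : SimpleGraph n) (pos : Fin n → Point) where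
    open SimpleGraph G

    DistinctPoints : Set (ℓ₁)
    DistinctPoints = ∀ a b → pos a ≈P pos b → a ≡ b

    NoVertexOnEdge : Set (c ⊔ ℓ₁ ⊔ ℓ₂)
    NoVertexOnEdge = ∀ a b w → Adj a b → ¬ (w ≡ a) → ¬ (w ≡ b) →
                     ¬ OnSegment (pos w) (pos a) (pos b)

    -- Every crossing is between a horizontal and a vertical edge
    -- (this is the RAC condition plus axis-parallelism of crossing edges).
    CrossingsAxisParallel : Set (c ⊔ ℓ₁ ⊔ ℓ₂)
    CrossingsAxisParallel = ∀ a b c' d → Adj a b → Adj c' d →
      ¬ (a ≡ c') → ¬ (a ≡ d) → ¬ (b ≡ c') → ¬ (b ≡ d) →
      SegmentsMeet (pos a) (pos b) (pos c') (pos d) →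
      (Horizontal (pos a) (pos b) × Vertical (pos c') (pos d)) ⊎
      (Vertical (pos a) (pos b) × Horizontal (pos c') (pos d))

    record IsApRACDrawing : Set (c ⊔ ℓ₁ ⊔ ℓ₂) where
      field
        distinct    : DistinctPoints
        noVertexOn  : NoVertexOnEdge
        crossings   : CrossingsAxisParallel

-- The exit point of an edge from the interior vertex u is located in barycentric
-- coordinates: moving from u to an outside vertex v, the coordinates go from all
-- positive to not all nonnegative, and the first one to vanish names the side of
-- the triangle that the edge uv crosses. In an apRAC drawing that crossing is
-- between a horizontal and a vertical segment, so by pigeonhole two of the three
-- edges u v, u w are parallel, say horizontal, and cross vertical sides. Distinct
-- vertical sides would make the triangle degenerate, which is impossible since no
-- vertex lies on an edge. The same side is met by both edges at the point with the
-- side's abscissa and u's ordinate, so uv and uw share a point other than u; then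
-- one of v, w lies on the other edge, again contradicting the drawing.

module Submission where

open import Defs
open import Data.Nat using (ℕ)
open import Data.Fin using (Fin)
open import Data.Product using (_×_; ∃-syntax)
open import Relation.Nullary using (¬_)
open import Relation.Binary.PropositionalEquality using (_≡_)

open import Algebra.Bundles using (CommutativeRing)
open import Algebra.Solver.Ring.AlmostCommutativeRing
  using (_-Raw-AlmostCommutative⟶_; fromCommutativeRing)
open import Data.Empty using (⊥; ⊥-elim)
open import Data.Fin as Fin using (zero; suc)
open import Data.Fin.Patterns using (0F; 1F; 2F)
open import Data.Integer as ℤ using (ℤ; +_; -[1+_]; _⊖_)
import Data.Integer.Properties as ℤ
open import Data.Maybe using (Maybe; just; nothing)
open import Data.Nat as ℕ using (zero; suc)
import Data.Nat.Properties as ℕ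
open import Data.Product using (_,_; proj₁; proj₂)
open import Data.Sign as Sign using (Sign)
open import Data.Sum using (_⊎_; inj₁; inj₂; [_,_]′)
open import Data.Vec.Functional using (_∷_; [])
open import Function using (_∘_)
open import Level using (_⊔_)
open import Relation.Binary.PropositionalEquality as ≡ using ()
open import Relation.Binary.Structures using (IsTotalOrder)
open import Relation.Nullary using (yes; no)

-- Normalising over an arbitrary commutative ring needs integer coefficients: with the
-- ring itself as coefficient domain (Tactic.RingSolver) x - x cannot be normalised to 0.
-- Solver constants other than 0 evaluate to unfolded numerals (⟦ + 1 ⟧ℤ is 1# + 0#),
-- so the identities below that involve 1# abstract it as a variable.
module CommutativeRingSolver {c ℓ} (R : CommutativeRing c ℓ) where
  open CommutativeRing R
  open import Algebra.Properties.Ring ring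
    using (-‿involutive; -1*x≈-x; -‿distribʳ-*; -0#≈0#; -‿+-comm)
  open import Algebra.Properties.Semiring.Mult semiring
    using (×1-homo-*; ×-homo-+) renaming (_×_ to _·_)
  open import Algebra.Properties.CommutativeSemigroup +-commutativeSemigroup
    using () renaming (interchange to +-interchange)
  open import Algebra.Properties.CommutativeSemigroup *-commutativeSemigroup
    using () renaming (interchange to *-interchange)
  open import Relation.Binary.Reasoning.Setoid setoid

  ⟦_⟧ℤ : ℤ → Carrier
  ⟦ + n ⟧ℤ      = n · 1#
  ⟦ -[1+ n ] ⟧ℤ = - (suc n · 1#)

  ⟦_⟧± : Sign → Carrier
  ⟦ Sign.+ ⟧± = 1#
  ⟦ Sign.- ⟧± = - 1#

  ⟦◃⟧ : ∀ s n → ⟦ s ℤ.◃ n ⟧ℤ ≈ ⟦ s ⟧± * (n · 1#)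
  ⟦◃⟧ s      zero    = sym (zeroʳ ⟦ s ⟧±)
  ⟦◃⟧ Sign.+ (suc n) = sym (*-identityˡ _)
  ⟦◃⟧ Sign.- (suc n) = sym (-1*x≈-x _)

  ⟦sign◃abs⟧ : ∀ i → ⟦ i ⟧ℤ ≈ ⟦ ℤ.sign i ⟧± * (ℤ.∣ i ∣ · 1#)
  ⟦sign◃abs⟧ (+ n)    = sym (*-identityˡ _)
  ⟦sign◃abs⟧ -[1+ n ] = sym (-1*x≈-x _)

  ⟦*⟧± : ∀ s t → ⟦ s Sign.* t ⟧± ≈ ⟦ s ⟧± * ⟦ t ⟧±
  ⟦*⟧± Sign.+ t      = sym (*-identityˡ _)
  ⟦*⟧± Sign.- Sign.+ = sym (*-identityʳ _)
  ⟦*⟧± Sign.- Sign.- = begin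
    1#             ≈⟨ sym (-‿involutive 1#) ⟩
    - (- 1#)       ≈⟨ -‿cong (sym (-1*x≈-x 1#)) ⟩
    - (- 1# * 1#)  ≈⟨ -‿distribʳ-* (- 1#) 1# ⟩
    - 1# * - 1#    ∎

  ⟦*⟧ℤ : ∀ i j → ⟦ i ℤ.* j ⟧ℤ ≈ ⟦ i ⟧ℤ * ⟦ j ⟧ℤ
  ⟦*⟧ℤ i j = begin
    ⟦ i ℤ.* j ⟧ℤ
      ≈⟨ ⟦◃⟧ (ℤ.sign i Sign.* ℤ.sign j) (ℤ.∣ i ∣ ℕ.* ℤ.∣ j ∣) ⟩
    ⟦ ℤ.sign i Sign.* ℤ.sign j ⟧± * ((ℤ.∣ i ∣ ℕ.* ℤ.∣ j ∣) · 1#)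
      ≈⟨ *-cong (⟦*⟧± (ℤ.sign i) (ℤ.sign j)) (×1-homo-* ℤ.∣ i ∣ ℤ.∣ j ∣) ⟩
    (⟦ ℤ.sign i ⟧± * ⟦ ℤ.sign j ⟧±) * ((ℤ.∣ i ∣ · 1#) * (ℤ.∣ j ∣ · 1#))
      ≈⟨ *-interchange _ _ _ _ ⟩
    (⟦ ℤ.sign i ⟧± * (ℤ.∣ i ∣ · 1#)) * (⟦ ℤ.sign j ⟧± * (ℤ.∣ j ∣ · 1#))
      ≈⟨ sym (*-cong (⟦sign◃abs⟧ i) (⟦sign◃abs⟧ j)) ⟩
    ⟦ i ⟧ℤ * ⟦ j ⟧ℤ ∎

  ⟦⊖⟧ : ∀ m n → ⟦ m ⊖ n ⟧ℤ ≈ (m · 1#) - (n · 1#)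
  ⟦⊖⟧ zero zero = sym (-‿inverseʳ 0#)
  ⟦⊖⟧ zero (suc n) = sym (+-identityˡ _)
  ⟦⊖⟧ (suc m) zero = sym (trans (+-congˡ -0#≈0#) (+-identityʳ _))
  ⟦⊖⟧ (suc m) (suc n) = begin
    ⟦ suc m ⊖ suc n ⟧ℤ                         ≡⟨ ≡.cong ⟦_⟧ℤ (ℤ.[1+m]⊖[1+n]≡m⊖n m n) ⟩
    ⟦ m ⊖ n ⟧ℤ                                 ≈⟨ ⟦⊖⟧ m n ⟩
    (m · 1#) - (n · 1#)                        ≈⟨ +-identityˡ _ ⟨
    0# + ((m · 1#) - (n · 1#))                 ≈⟨ +-congʳ (-‿inverseʳ 1#) ⟨
    (1# - 1#) + ((m · 1#) - (n · 1#))          ≈⟨ +-interchange 1# (- 1#) (m · 1#) (- (n · 1#)) ⟩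
    (1# + m · 1#) + (- 1# + - (n · 1#))        ≈⟨ +-congˡ (-‿+-comm 1# (n · 1#)) ⟩
    (suc m · 1#) - (suc n · 1#)                ∎

  ⟦+⟧ℤ : ∀ i j → ⟦ i ℤ.+ j ⟧ℤ ≈ ⟦ i ⟧ℤ + ⟦ j ⟧ℤ
  ⟦+⟧ℤ (+ m)    (+ n)    = ×-homo-+ 1# m n
  ⟦+⟧ℤ (+ m)    -[1+ n ] = ⟦⊖⟧ m (suc n)
  ⟦+⟧ℤ -[1+ m ] (+ n)    = trans (⟦⊖⟧ n (suc m)) (+-comm _ _)
  ⟦+⟧ℤ -[1+ m ] -[1+ n ] = begin
    - (suc (suc (m ℕ.+ n)) · 1#)          ≡⟨ ≡.cong (λ k → - (suc k · 1#)) (ℕ.+-suc m n) ⟨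
    - ((suc m ℕ.+ suc n) · 1#)            ≈⟨ -‿cong (×-homo-+ 1# (suc m) (suc n)) ⟩
    - ((suc m · 1#) + (suc n · 1#))       ≈⟨ -‿+-comm _ _ ⟨
    - (suc m · 1#) + - (suc n · 1#)       ∎

  ⟦-⟧ℤ : ∀ i → ⟦ ℤ.- i ⟧ℤ ≈ - ⟦ i ⟧ℤ
  ⟦-⟧ℤ (+ zero)  = sym -0#≈0#
  ⟦-⟧ℤ (+ suc n) = refl
  ⟦-⟧ℤ -[1+ n ]  = sym (-‿involutive _)

  homomorphism : ℤ.+-*-rawRing -Raw-AlmostCommutative⟶ fromCommutativeRing R
  homomorphism = record
    { ⟦_⟧    = ⟦_⟧ℤ
    ; +-homo = ⟦+⟧ℤ
    ; *-homo = ⟦*⟧ℤ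
    ; -‿homo = ⟦-⟧ℤ
    ; 0-homo = refl
    ; 1-homo = +-identityʳ 1#
    }

  coefficient≟ : ∀ i j → Maybe (⟦ i ⟧ℤ ≈ ⟦ j ⟧ℤ)
  coefficient≟ i j with i ℤ.≟ j
  ... | yes ≡.refl = just refl
  ... | no _       = nothing

  open import Algebra.Solver.Ring ℤ.+-*-rawRing (fromCommutativeRing R) homomorphism coefficient≟ public

module OrderedFieldProperties {c ℓ₁ ℓ₂} (F : OrderedField c ℓ₁ ℓ₂) where
  open OrderedField F hiding (zero)
  open CommutativeRingSolver commutativeRing using (solve; _:=_; _:+_; _:*_; _:-_; :-_)
  open import Algebra.Properties.Ring ring using (-‿distribʳ-*; x≈y⇒x∙y⁻¹≈ε)
  open import Relation.Binary.Reasoning.Setoid setoid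
  open IsTotalOrder isTotalOrder public
    using (total; antisym) renaming (refl to ≤-refl; trans to ≤-trans; reflexive to ≤-reflexive)

  ≤-resp-≈ : ∀ {a a′ b b′} → a ≈ a′ → b ≈ b′ → a ≤ b → a′ ≤ b′
  ≤-resp-≈ a≈a′ b≈b′ a≤b = ≤-trans (≤-reflexive (sym a≈a′)) (≤-trans a≤b (≤-reflexive b≈b′))

  x≈y⇒y-x≈0 : ∀ {a b} → a ≈ b → b - a ≈ 0#
  x≈y⇒y-x≈0 a≈b = x≈y⇒x∙y⁻¹≈ε (sym a≈b)

  x≈y+z⇒x-y≈z : ∀ {a b d} → a ≈ b + d → a - b ≈ d
  x≈y+z⇒x-y≈z {a} {b} {d} a≈b+d = trans (+-congʳ a≈b+d) (cancel b d)
    where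
    cancel : ∀ b d → (b + d) - b ≈ d
    cancel = solve 2 (λ b d → (b :+ d) :- b := d) refl

  x-y≈z⇒x≈y+z : ∀ {a b d} → a - b ≈ d → a ≈ b + d
  x-y≈z⇒x≈y+z {a} {b} {d} a-b≈d = trans (sym (cancel a b)) (+-congˡ a-b≈d)
    where
    cancel : ∀ a b → b + (a - b) ≈ a
    cancel = solve 2 (λ a b → b :+ (a :- b) := a) refl

  x≤y⇒0≤y-x : ∀ {a b} → a ≤ b → 0# ≤ (b - a)
  x≤y⇒0≤y-x {a} a≤b = ≤-resp-≈ (-‿inverseʳ a) refl (+-mono-≤ (- a) a≤b)

  0≤y-x⇒x≤y : ∀ {a b} → 0# ≤ (b - a) → a ≤ b
  0≤y-x⇒x≤y {a} {b} 0≤b-a = ≤-resp-≈ (+-identityˡ a) (cancel a b) (+-mono-≤ a 0≤b-a)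
    where
    cancel : ∀ a b → (b - a) + a ≈ b
    cancel = solve 2 (λ a b → (b :- a) :+ a := b) refl

  x≤0⇒0≤-x : ∀ {a} → a ≤ 0# → 0# ≤ (- a)
  x≤0⇒0≤-x {a} a≤0 = ≤-resp-≈ refl (+-identityˡ (- a)) (x≤y⇒0≤y-x a≤0)

  0≤-x⇒x≤0 : ∀ {a} → 0# ≤ (- a) → a ≤ 0#
  0≤-x⇒x≤0 {a} 0≤-a = 0≤y-x⇒x≤y (≤-resp-≈ refl (sym (+-identityˡ (- a))) 0≤-a)

  0≤1 : 0# ≤ 1#
  0≤1 with total 0# 1#
  ... | inj₁ 0≤1 = 0≤1
  ... | inj₂ 1≤0 = ≤-resp-≈ refl (trans (neg-square 1#) (*-identityˡ 1#))
                     (*-nonneg (x≤0⇒0≤-x 1≤0) (x≤0⇒0≤-x 1≤0))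
    where
    neg-square : ∀ a → (- a) * (- a) ≈ a * a
    neg-square = solve 1 (λ a → (:- a) :* (:- a) := a :* a) refl

  1≰0 : ¬ (1# ≤ 0#)
  1≰0 1≤0 = 0≉1 (antisym 0≤1 1≤0)

  *-monoˡ-≤-nonneg : ∀ {a b d} → 0# ≤ a → b ≤ d → (a * b) ≤ (a * d)
  *-monoˡ-≤-nonneg {a} {b} {d} 0≤a b≤d =
    0≤y-x⇒x≤y (≤-resp-≈ refl (*-distribˡ-- a b d) (*-nonneg 0≤a (x≤y⇒0≤y-x b≤d)))
    where
    *-distribˡ-- : ∀ a b d → a * (d - b) ≈ a * d - a * b
    *-distribˡ-- = solve 3 (λ a b d → a :* (d :- b) := a :* d :- a :* b) refl

  *-nonzero : ∀ {a b} → ¬ (a ≈ 0#) → ¬ (b ≈ 0#) → ¬ (a * b ≈ 0#)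
  *-nonzero {a} {b} a≉0 b≉0 ab≈0 with inverse a a≉0
  ... | a⁻¹ , aa⁻¹≈1 = b≉0 (begin
    b                ≈⟨ *-identityˡ b ⟨
    1# * b           ≈⟨ *-congʳ aa⁻¹≈1 ⟨
    (a * a⁻¹) * b    ≈⟨ reassoc a a⁻¹ b ⟩
    a⁻¹ * (a * b)    ≈⟨ *-congˡ ab≈0 ⟩
    a⁻¹ * 0#         ≈⟨ zeroʳ a⁻¹ ⟩
    0#               ∎)
    where
    reassoc : ∀ a a⁻¹ b → (a * a⁻¹) * b ≈ a⁻¹ * (a * b)
    reassoc = solve 3 (λ a a⁻¹ b → (a :* a⁻¹) :* b := a⁻¹ :* (a :* b)) refl

  0<x⇒x≉0 : ∀ {a} → 0# < a → ¬ (a ≈ 0#)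
  0<x⇒x≉0 (_ , 0≉a) a≈0 = 0≉a (sym a≈0)

  inverse-nonneg : ∀ {a b} → 0# ≤ a → a * b ≈ 1# → 0# ≤ b
  inverse-nonneg {a} {b} 0≤a ab≈1 with total 0# b
  ... | inj₁ 0≤b = 0≤b
  ... | inj₂ b≤0 = ⊥-elim (1≰0 (0≤-x⇒x≤0 0≤-1))
    where
    0≤-1 : 0# ≤ (- 1#)
    0≤-1 = ≤-resp-≈ refl (trans (sym (-‿distribʳ-* a b)) (-‿cong ab≈1))
             (*-nonneg 0≤a (x≤0⇒0≤-x b≤0))

  1≤x⇒x≉0 : ∀ {a} → 1# ≤ a → ¬ (a ≈ 0#)
  1≤x⇒x≉0 1≤a a≈0 = 1≰0 (≤-resp-≈ refl a≈0 1≤a)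

  x≤0⇒1≤1-x : ∀ {a} → a ≤ 0# → 1# ≤ (1# - a)
  x≤0⇒1≤1-x {a} a≤0 = 0≤y-x⇒x≤y (≤-resp-≈ refl (sym (cancel 1# a)) (x≤0⇒0≤-x a≤0))
    where
    cancel : ∀ o a → (o - a) - o ≈ - a
    cancel = solve 2 (λ o a → (o :- a) :- o := :- a) refl

  reciprocal-of-≥1 : ∀ {a} → 1# ≤ a → ∃[ b ] (a * b ≈ 1#) × (0# ≤ b) × (b ≤ 1#)
  reciprocal-of-≥1 {a} 1≤a with inverse a (1≤x⇒x≉0 1≤a)
  ... | b , ab≈1 = b , ab≈1 , 0≤b , 0≤y-x⇒x≤y (≤-resp-≈ refl b[a-1]≈1-b (*-nonneg 0≤b (x≤y⇒0≤y-x 1≤a)))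
    where
    0≤b : 0# ≤ b
    0≤b = inverse-nonneg (≤-trans 0≤1 1≤a) ab≈1
    expand : ∀ a b o → b * (a - o) ≈ a * b - b * o
    expand = solve 3 (λ a b o → b :* (a :- o) := a :* b :- b :* o) refl
    b[a-1]≈1-b : b * (a - 1#) ≈ 1# - b
    b[a-1]≈1-b = trans (expand a b 1#) (+-cong ab≈1 (-‿cong (*-identityʳ b)))

  proportional : ∀ {α β γ δ} → ¬ (α ≈ 0#) → α * δ ≈ β * γ →
                 ∃[ r ] (γ ≈ r * α) × (δ ≈ r * β)
  proportional {α} {β} {γ} {δ} α≉0 αδ≈βγ with inverse α α≉0
  ... | α⁻¹ , αα⁻¹≈1 = γ * α⁻¹ , γ≈rα , δ≈rβ
    where
    α⁻¹α≈1 : α⁻¹ * α ≈ 1#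
    α⁻¹α≈1 = trans (*-comm α⁻¹ α) αα⁻¹≈1
    γ≈rα : γ ≈ (γ * α⁻¹) * α
    γ≈rα = begin
      γ                  ≈⟨ *-identityʳ γ ⟨
      γ * 1#             ≈⟨ *-congˡ α⁻¹α≈1 ⟨
      γ * (α⁻¹ * α)      ≈⟨ *-assoc γ α⁻¹ α ⟨
      (γ * α⁻¹) * α      ∎
    δ≈rβ : δ ≈ (γ * α⁻¹) * β
    δ≈rβ = begin
      δ                  ≈⟨ *-identityˡ δ ⟨
      1# * δ             ≈⟨ *-congʳ α⁻¹α≈1 ⟨
      (α⁻¹ * α) * δ      ≈⟨ *-assoc α⁻¹ α δ ⟩
      α⁻¹ * (α * δ)      ≈⟨ *-congˡ αδ≈βγ ⟩
      α⁻¹ * (β * γ)      ≈⟨ rearrange α⁻¹ β γ ⟩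
      (γ * α⁻¹) * β      ∎
      where
      rearrange : ∀ a b d → a * (b * d) ≈ (d * a) * b
      rearrange = solve 3 (λ a b d → a :* (b :* d) := (d :* a) :* b) refl

  ratio-∈[0,1] : ∀ {s t} → ¬ (s ≈ 0#) → 0# ≤ t → t ≤ s →
                 ∃[ ρ ] (0# ≤ ρ) × (ρ ≤ 1#) × (∀ {A B} → s * A ≈ t * B → A ≈ ρ * B)
  ratio-∈[0,1] {s} {t} s≉0 0≤t t≤s with inverse s s≉0
  ... | s⁻¹ , ss⁻¹≈1 = s⁻¹ * t , *-nonneg 0≤s⁻¹ 0≤t , ρ≤1 , scale
    where
    0≤s⁻¹ : 0# ≤ s⁻¹
    0≤s⁻¹ = inverse-nonneg (≤-trans 0≤t t≤s) ss⁻¹≈1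
    ρ≤1 : (s⁻¹ * t) ≤ 1#
    ρ≤1 = ≤-resp-≈ refl (trans (*-comm s⁻¹ s) ss⁻¹≈1) (*-monoˡ-≤-nonneg 0≤s⁻¹ t≤s)
    scale : ∀ {A B} → s * A ≈ t * B → A ≈ (s⁻¹ * t) * B
    scale {A} {B} sA≈tB = begin
      A                  ≈⟨ *-identityˡ A ⟨
      1# * A             ≈⟨ *-congʳ ss⁻¹≈1 ⟨
      (s * s⁻¹) * A      ≈⟨ reassoc s s⁻¹ A ⟩
      s⁻¹ * (s * A)      ≈⟨ *-congˡ sA≈tB ⟩
      s⁻¹ * (t * B)      ≈⟨ *-assoc s⁻¹ t B ⟨
      (s⁻¹ * t) * B      ∎
      where
      reassoc : ∀ a b d → (a * b) * d ≈ b * (a * d)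
      reassoc = solve 3 (λ a b d → (a :* b) :* d := b :* (a :* d)) refl

  argmin : ∀ {n} (f : Fin (suc n) → Carrier) → ∃[ k ] (∀ j → f k ≤ f j)
  argmin {zero} f = zero , λ { zero → ≤-refl }
  argmin {suc n} f with argmin (f ∘ suc)
  ... | k , min with total (f zero) (f (suc k))
  ...   | inj₁ f₀≤fₖ = zero , λ { zero → ≤-refl ; (suc j) → ≤-trans f₀≤fₖ (min j) }
  ...   | inj₂ fₖ≤f₀ = suc k , λ { zero → fₖ≤f₀ ; (suc j) → min j }

  interpolate : ∀ {n} → (Fin n → Carrier) → (Fin n → Carrier) → Carrier → Fin n → Carrier
  interpolate l m s j = l j + s * (m j - l j)

  -- The exit parameter is s = 1 / (1 - min_j (m j / l j)).
  interpolation-leaves-orthant :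
    ∀ {n} (l m : Fin (suc n) → Carrier) → (∀ j → 0# < l j) → ¬ (∀ j → 0# ≤ m j) →
    ∃[ s ] (0# ≤ s) × (s ≤ 1#) × (∀ j → 0# ≤ interpolate l m s j) × ∃[ k ] (interpolate l m s k ≈ 0#)
  interpolation-leaves-orthant l m 0<l m≱0 = s , 0≤s , s≤1 , interpolant-nonneg , k , interpolantₖ≈0
    where
    l≉0 : ∀ j → ¬ (l j ≈ 0#)
    l≉0 j = 0<x⇒x≉0 (0<l j)
    l⁻¹ : Fin _ → Carrier
    l⁻¹ j = proj₁ (inverse (l j) (l≉0 j))
    r : Fin _ → Carrier
    r j = m j * l⁻¹ j
    m≈rl : ∀ j → m j ≈ r j * l j
    m≈rl j = sym (begin
      (m j * l⁻¹ j) * l j   ≈⟨ reassoc (m j) (l⁻¹ j) (l j) ⟩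
      m j * (l j * l⁻¹ j)   ≈⟨ *-congˡ (proj₂ (inverse (l j) (l≉0 j))) ⟩
      m j * 1#              ≈⟨ *-identityʳ (m j) ⟩
      m j                   ∎)
      where
      reassoc : ∀ a b d → (a * b) * d ≈ a * (d * b)
      reassoc = solve 3 (λ a b d → (a :* b) :* d := a :* (d :* b)) refl
    k : Fin _
    k = proj₁ (argmin r)
    rₖ≤r : ∀ j → r k ≤ r j
    rₖ≤r = proj₂ (argmin r)
    rₖ≤0 : r k ≤ 0#
    rₖ≤0 with total (r k) 0#
    ... | inj₁ rₖ≤0 = rₖ≤0
    ... | inj₂ 0≤rₖ = ⊥-elim (m≱0 λ j →
      ≤-resp-≈ refl (sym (m≈rl j)) (*-nonneg (≤-trans 0≤rₖ (rₖ≤r j)) (proj₁ (0<l j))))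
    reciprocal : ∃[ s ] ((1# - r k) * s ≈ 1#) × (0# ≤ s) × (s ≤ 1#)
    reciprocal = reciprocal-of-≥1 (x≤0⇒1≤1-x rₖ≤0)
    s : Carrier
    s = proj₁ reciprocal
    [1-rₖ]s≈1 : (1# - r k) * s ≈ 1#
    [1-rₖ]s≈1 = proj₁ (proj₂ reciprocal)
    0≤s : 0# ≤ s
    0≤s = proj₁ (proj₂ (proj₂ reciprocal))
    s≤1 : s ≤ 1#
    s≤1 = proj₂ (proj₂ (proj₂ reciprocal))
    interpolant≈ : ∀ j → interpolate l m s j ≈ (l j * s) * (r j - r k)
    interpolant≈ j = begin
      l j + s * (m j - l j)                                  ≈⟨ +-cong (sym (*-identityʳ (l j)))
                                                                   (*-congˡ (+-cong (m≈rl j) (-‿cong (sym (*-identityʳ (l j)))))) ⟩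
      l j * 1# + s * (r j * l j - l j * 1#)                  ≈⟨ expand (l j) s (r j) (r k) 1# ⟩
      (l j * s) * (r j - r k) + l j * (1# - (1# - r k) * s)  ≈⟨ +-congˡ (*-congˡ (x≈y⇒y-x≈0 [1-rₖ]s≈1)) ⟩
      (l j * s) * (r j - r k) + l j * 0#                     ≈⟨ +-congˡ (zeroʳ (l j)) ⟩
      (l j * s) * (r j - r k) + 0#                           ≈⟨ +-identityʳ _ ⟩
      (l j * s) * (r j - r k)                                ∎
      where
      expand : ∀ l s r rₖ o → l * o + s * (r * l - l * o) ≈ (l * s) * (r - rₖ) + l * (o - (o - rₖ) * s)
      expand = solve 5 (λ l s r rₖ o →
        l :* o :+ s :* (r :* l :- l :* o) := (l :* s) :* (r :- rₖ) :+ l :* (o :- (o :- rₖ) :* s)) refl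
    interpolant-nonneg : ∀ j → 0# ≤ interpolate l m s j
    interpolant-nonneg j = ≤-resp-≈ refl (sym (interpolant≈ j))
      (*-nonneg (*-nonneg (proj₁ (0<l j)) 0≤s) (x≤y⇒0≤y-x (rₖ≤r j)))
    interpolantₖ≈0 : interpolate l m s k ≈ 0#
    interpolantₖ≈0 = trans (interpolant≈ k) (trans (*-congˡ (-‿inverseʳ (r k))) (zeroʳ _))

next : Fin 3 → Fin 3
next 0F = 1F
next 1F = 2F
next 2F = 0F

module PlaneGeometry {c ℓ₁ ℓ₂} (F : OrderedField c ℓ₁ ℓ₂) where
  open OrderedField F hiding (zero)
  open OrderedFieldProperties F
  open Geometry F
  open CommutativeRingSolver commutativeRing using (solve; _:=_; _:+_; _:*_; _:-_; :-_; con)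
  open import Algebra.Properties.Ring ring using (-0#≈0#; x∙y⁻¹≈ε⇒x≈y)
  open import Relation.Binary.Reasoning.Setoid setoid

  ≈P-sym : ∀ {p q} → p ≈P q → q ≈P p
  ≈P-sym (px≈qx , py≈qy) = sym px≈qx , sym py≈qy

  ≈P-trans : ∀ {p q r} → p ≈P q → q ≈P r → p ≈P r
  ≈P-trans (px≈qx , py≈qy) (qx≈rx , qy≈ry) = trans px≈qx qx≈rx , trans py≈qy qy≈ry

  OnLineAt : Carrier → Point → Point → Point → Set ℓ₁
  OnLineAt r c a b = (x c - x a ≈ r * (x b - x a)) × (y c - y a ≈ r * (y b - y a))

  onLine⇒onSegment : ∀ {t p a b} → 0# ≤ t → t ≤ 1# → OnLineAt t p a b → OnSegment p a b
  onLine⇒onSegment 0≤t t≤1 (δx , δy) = _ , 0≤t , t≤1 , x-y≈z⇒x≈y+z δx , x-y≈z⇒x≈y+z δy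

  onSegment⇒onLine : ∀ {p a b} → OnSegment p a b → ∃[ t ] (0# ≤ t) × (t ≤ 1#) × OnLineAt t p a b
  onSegment⇒onLine (t , 0≤t , t≤1 , px , py) = t , 0≤t , t≤1 , x≈y+z⇒x-y≈z px , x≈y+z⇒x-y≈z py

  onLine-at-0 : ∀ {t p a b} → OnLineAt t p a b → t ≈ 0# → p ≈P a
  onLine-at-0 {t} (δx , δy) t≈0 = vanish δx , vanish δy
    where
    vanish : ∀ {z z₁ z₂} → z - z₁ ≈ t * (z₂ - z₁) → z ≈ z₁
    vanish δ = x∙y⁻¹≈ε⇒x≈y _ _ (trans δ (trans (*-congʳ t≈0) (zeroˡ _)))

  OnSegment-resp-≈P : ∀ {p q a b} → p ≈P q → OnSegment p a b → OnSegment q a b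
  OnSegment-resp-≈P (px≈qx , py≈qy) (t , 0≤t , t≤1 , px , py) =
    t , 0≤t , t≤1 , trans (sym px≈qx) px , trans (sym py≈qy) py

  along : Point → Point → Carrier → Point
  along a b t = x a + t * (x b - x a) , y a + t * (y b - y a)

  along-onSegment : ∀ {a b t} → 0# ≤ t → t ≤ 1# → OnSegment (along a b t) a b
  along-onSegment 0≤t t≤1 = _ , 0≤t , t≤1 , refl , refl

  weights⇒onSegment : ∀ {α β p a b} → 0# ≤ α → 0# ≤ β → α + β ≈ 1# →
                      x p ≈ α * x a + β * x b → y p ≈ α * y a + β * y b → OnSegment p a b
  weights⇒onSegment {α} {β} 0≤α 0≤β α+β≈1 px py =
    onLine⇒onSegment 0≤β (0≤y-x⇒x≤y (≤-resp-≈ refl α≈1-β 0≤α)) (offset px , offset py)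
    where
    α≈1-β : α ≈ 1# - β
    α≈1-β = sym (x≈y+z⇒x-y≈z (trans (sym α+β≈1) (+-comm α β)))
    offset : ∀ {z z₁ z₂} → z ≈ α * z₁ + β * z₂ → z - z₁ ≈ β * (z₂ - z₁)
    offset {z} {z₁} {z₂} z≈ = begin
      z - z₁                                ≈⟨ +-cong z≈ (-‿cong (trans (sym (*-identityˡ z₁)) (*-congʳ (sym α+β≈1)))) ⟩
      (α * z₁ + β * z₂) - (α + β) * z₁      ≈⟨ regroup α β z₁ z₂ ⟩
      β * (z₂ - z₁)                         ∎
      where
      regroup : ∀ α β z₁ z₂ → (α * z₁ + β * z₂) - (α + β) * z₁ ≈ β * (z₂ - z₁)
      regroup = solve 4 (λ α β z₁ z₂ → (α :* z₁ :+ β :* z₂) :- (α :+ β) :* z₁ := β :* (z₂ :- z₁)) refl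

  horizontal-meets-vertical : ∀ {p a b c d} → Horizontal a b → Vertical c d →
                              OnSegment p a b → OnSegment p c d → p ≈P (x c , y a)
  horizontal-meets-vertical ya≈yb xc≈xd (_ , _ , _ , _ , py) (_ , _ , _ , px , _) =
    constant px xc≈xd , constant py ya≈yb
    where
    constant : ∀ {z z₁ z₂ t} → z ≈ z₁ + t * (z₂ - z₁) → z₁ ≈ z₂ → z ≈ z₁
    constant {t = t} z≈ z₁≈z₂ =
      trans z≈ (trans (+-congˡ (trans (*-congˡ (x≈y⇒y-x≈0 z₁≈z₂)) (zeroʳ t))) (+-identityʳ _))

  shared-point⇒onSegment : ∀ {s t p a b c} → ¬ (t ≈ 0#) → 0# ≤ s → s ≤ t →
                           OnLineAt s p a b → OnLineAt t p a c → OnSegment c a b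
  shared-point⇒onSegment t≉0 0≤s s≤t (δxb , δyb) (δxc , δyc)
    with ratio-∈[0,1] t≉0 0≤s s≤t
  ... | ρ , 0≤ρ , ρ≤1 , scale =
    onLine⇒onSegment 0≤ρ ρ≤1 (scale (trans (sym δxc) δxb) , scale (trans (sym δyc) δyb))

  segments-from-common-point : ∀ {p a b c} → OnSegment p a b → OnSegment p a c → ¬ (p ≈P a) →
                               OnSegment b a c ⊎ OnSegment c a b
  segments-from-common-point p∈ab p∈ac p≉a
    with onSegment⇒onLine p∈ab | onSegment⇒onLine p∈ac
  ... | s , 0≤s , _ , p-on-ab | t , 0≤t , _ , p-on-ac with total s t
  ...   | inj₁ s≤t = inj₂ (shared-point⇒onSegment (p≉a ∘ onLine-at-0 p-on-ac) 0≤s s≤t p-on-ab p-on-ac)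
  ...   | inj₂ t≤s = inj₁ (shared-point⇒onSegment (p≉a ∘ onLine-at-0 p-on-ab) 0≤t t≤s p-on-ac p-on-ab)

  onLine-reciprocal : ∀ {r r′ a b c} → OnLineAt r c a b → r * r′ ≈ 1# → OnLineAt r′ b a c
  onLine-reciprocal {r} {r′} (δx , δy) rr′≈1 = invert δx , invert δy
    where
    invert : ∀ {z₁ z₂ z₃} → z₃ - z₁ ≈ r * (z₂ - z₁) → z₂ - z₁ ≈ r′ * (z₃ - z₁)
    invert {z₁} {z₂} {z₃} δ = begin
      z₂ - z₁                 ≈⟨ *-identityˡ _ ⟨
      1# * (z₂ - z₁)          ≈⟨ *-congʳ (trans (*-comm r′ r) rr′≈1) ⟨
      (r′ * r) * (z₂ - z₁)    ≈⟨ *-assoc r′ r _ ⟩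
      r′ * (r * (z₂ - z₁))    ≈⟨ *-congˡ δ ⟨
      r′ * (z₃ - z₁)          ∎

  onLine-reverse : ∀ {r q a b c} → OnLineAt r c a b → (1# - r) * q ≈ 1# → OnLineAt q a b c
  onLine-reverse {r} {q} (δx , δy) [1-r]q≈1 = reverse δx , reverse δy
    where
    reverse : ∀ {z₁ z₂ z₃} → z₃ - z₁ ≈ r * (z₂ - z₁) → z₁ - z₂ ≈ q * (z₃ - z₂)
    reverse {z₁} {z₂} {z₃} δ = sym (begin
      q * (z₃ - z₂)                         ≈⟨ *-congˡ (split z₁ z₂ z₃) ⟩
      q * ((z₃ - z₁) - 1# * (z₂ - z₁))      ≈⟨ *-congˡ (+-congʳ δ) ⟩
      q * (r * (z₂ - z₁) - 1# * (z₂ - z₁))  ≈⟨ regroup q r 1# (z₂ - z₁) ⟩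
      - (((1# - r) * q) * (z₂ - z₁))        ≈⟨ -‿cong (*-congʳ [1-r]q≈1) ⟩
      - (1# * (z₂ - z₁))                    ≈⟨ -‿cong (*-identityˡ _) ⟩
      - (z₂ - z₁)                           ≈⟨ negate z₁ z₂ ⟩
      z₁ - z₂                               ∎)
      where
      split : ∀ z₁ z₂ z₃ → z₃ - z₂ ≈ (z₃ - z₁) - 1# * (z₂ - z₁)
      split z₁ z₂ z₃ = trans (difference z₁ z₂ z₃) (+-congˡ (-‿cong (sym (*-identityˡ _))))
        where
        difference : ∀ z₁ z₂ z₃ → z₃ - z₂ ≈ (z₃ - z₁) - (z₂ - z₁)
        difference = solve 3 (λ z₁ z₂ z₃ → z₃ :- z₂ := (z₃ :- z₁) :- (z₂ :- z₁)) refl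
      regroup : ∀ q r o d → q * (r * d - o * d) ≈ - (((o - r) * q) * d)
      regroup = solve 4 (λ q r o d → q :* (r :* d :- o :* d) := :- (((o :- r) :* q) :* d)) refl
      negate : ∀ z₁ z₂ → - (z₂ - z₁) ≈ z₁ - z₂
      negate = solve 2 (λ z₁ z₂ → :- (z₂ :- z₁) := z₁ :- z₂) refl

  collinear⇒onSegment : ∀ {r a b c} → OnLineAt r c a b →
                        OnSegment c a b ⊎ OnSegment b a c ⊎ OnSegment a b c
  collinear⇒onSegment {r} {a} {b} {c} c-on-ab with total 0# r
  ... | inj₂ r≤0 = inj₂ (inj₂ (reversed (reciprocal-of-≥1 (x≤0⇒1≤1-x r≤0))))
    where
    reversed : ∃[ q ] ((1# - r) * q ≈ 1#) × (0# ≤ q) × (q ≤ 1#) → OnSegment a b c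
    reversed (q , [1-r]q≈1 , 0≤q , q≤1) =
      onLine⇒onSegment {q} {a} {b} {c} 0≤q q≤1 (onLine-reverse c-on-ab [1-r]q≈1)
  ... | inj₁ 0≤r with total r 1#
  ...   | inj₁ r≤1 = inj₁ (onLine⇒onSegment {r} {c} {a} {b} 0≤r r≤1 c-on-ab)
  ...   | inj₂ 1≤r = inj₂ (inj₁ (beyond (reciprocal-of-≥1 1≤r)))
    where
    beyond : ∃[ r′ ] (r * r′ ≈ 1#) × (0# ≤ r′) × (r′ ≤ 1#) → OnSegment b a c
    beyond (r′ , rr′≈1 , 0≤r′ , r′≤1) =
      onLine⇒onSegment {r′} {b} {a} {c} 0≤r′ r′≤1 (onLine-reciprocal c-on-ab rr′≈1)

  det : Point → Point → Point → Carrier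
  det a b c = (x b - x a) * (y c - y a) - (y b - y a) * (x c - x a)

  det-repeatˡ : ∀ {a c} → det a a c ≈ 0#
  det-repeatˡ {a} {c} = vanish (x a) (y a) (x c) (y c)
    where
    vanish : ∀ xa ya xc yc → (xa - xa) * (yc - ya) - (ya - ya) * (xc - xa) ≈ 0#
    vanish = solve 4 (λ xa ya xc yc → (xa :- xa) :* (yc :- ya) :- (ya :- ya) :* (xc :- xa) := con (+ 0)) refl

  det-repeatʳ : ∀ {a b} → det a b b ≈ 0#
  det-repeatʳ {a} {b} = vanish (x a) (y a) (x b) (y b)
    where
    vanish : ∀ xa ya xb yb → (xb - xa) * (yb - ya) - (yb - ya) * (xb - xa) ≈ 0#
    vanish = solve 4 (λ xa ya xb yb → (xb :- xa) :* (yb :- ya) :- (yb :- ya) :* (xb :- xa) := con (+ 0)) refl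

  equal-x⇒det≈0 : ∀ {a b c} → (x a ≈ x b) × (x a ≈ x c) → det a b c ≈ 0#
  equal-x⇒det≈0 (xa≈xb , xa≈xc) =
    trans (+-cong (trans (*-congʳ (x≈y⇒y-x≈0 xa≈xb)) (zeroˡ _))
                  (-‿cong (trans (*-congˡ (x≈y⇒y-x≈0 xa≈xc)) (zeroʳ _))))
          (trans (+-identityˡ _) -0#≈0#)

  equal-y⇒det≈0 : ∀ {a b c} → (y a ≈ y b) × (y a ≈ y c) → det a b c ≈ 0#
  equal-y⇒det≈0 (ya≈yb , ya≈yc) =
    trans (+-cong (trans (*-congˡ (x≈y⇒y-x≈0 ya≈yc)) (zeroʳ _))
                  (-‿cong (trans (*-congʳ (x≈y⇒y-x≈0 ya≈yb)) (zeroˡ _))))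
          (trans (+-identityˡ _) -0#≈0#)

  det≈0⇒onLine-x : ∀ {a b c} → ¬ (x a ≈ x b) → det a b c ≈ 0# → ∃[ r ] OnLineAt r c a b
  det≈0⇒onLine-x {a} {b} {c} xa≉xb det≈0 =
    proportional {x b - x a} {y b - y a} {x c - x a} {y c - y a}
      (λ α≈0 → xa≉xb (sym (x∙y⁻¹≈ε⇒x≈y (x b) (x a) α≈0)))
      (x∙y⁻¹≈ε⇒x≈y _ _ det≈0)

  det≈0⇒onLine-y : ∀ {a b c} → ¬ (y a ≈ y b) → det a b c ≈ 0# → ∃[ r ] OnLineAt r c a b
  det≈0⇒onLine-y {a} {b} {c} ya≉yb det≈0
    with proportional {y b - y a} {x b - x a} {y c - y a} {x c - x a}
           (λ α≈0 → ya≉yb (sym (x∙y⁻¹≈ε⇒x≈y (y b) (y a) α≈0)))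
           (sym (x∙y⁻¹≈ε⇒x≈y _ _ det≈0))
  ... | r , δy , δx = r , δx , δy

  det≉0 : ∀ {a b c} → ¬ (a ≈P b) → ¬ OnSegment c a b → ¬ OnSegment b a c → ¬ OnSegment a b c →
          ¬ (det a b c ≈ 0#)
  -- ≈ is not decidable, so the cases x a ≉ x b and y a ≉ y b are split under the negated goal.
  det≉0 {a} {b} {c} a≉b c∉ab b∉ac a∉bc det≈0 =
    collinear⇒⊥ (det≈0⇒onLine-x {a} {b} {c} (λ xa≈xb →
      collinear⇒⊥ (det≈0⇒onLine-y {a} {b} {c} (λ ya≈yb → a≉b (xa≈xb , ya≈yb)) det≈0)) det≈0)
    where
    collinear⇒⊥ : ∃[ r ] OnLineAt r c a b → ⊥
    collinear⇒⊥ (_ , c-on-ab) = [ c∉ab , [ b∉ac , a∉bc ]′ ]′ (collinear⇒onSegment c-on-ab)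

  ∑₃ : (Fin 3 → Carrier) → Carrier
  ∑₃ f = f 0F + f 1F + f 2F

  ∑₃-rotate : ∀ f k → ∑₃ f ≈ f k + (f (next k) + f (next (next k)))
  ∑₃-rotate f 0F = +-assoc (f 0F) (f 1F) (f 2F)
  ∑₃-rotate f 1F = rotate (f 0F) (f 1F) (f 2F)
    where
    rotate : ∀ a b d → a + b + d ≈ b + (d + a)
    rotate = solve 3 (λ a b d → a :+ b :+ d := b :+ (d :+ a)) refl
  ∑₃-rotate f 2F = rotate (f 0F) (f 1F) (f 2F)
    where
    rotate : ∀ a b d → a + b + d ≈ d + (a + b)
    rotate = solve 3 (λ a b d → a :+ b :+ d := d :+ (a :+ b)) refl

  ∑₃-without : ∀ f k → f k ≈ 0# → ∑₃ f ≈ f (next k) + f (next (next k))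
  ∑₃-without f k fₖ≈0 = trans (∑₃-rotate f k) (trans (+-congʳ fₖ≈0) (+-identityˡ _))

  sides-cover : ∀ (f : Fin 3 → Carrier) {k k′} → ¬ (k ≡ k′) →
                f (next k) ≈ f (next (next k)) → f (next k′) ≈ f (next (next k′)) →
                (f 0F ≈ f 1F) × (f 0F ≈ f 2F)
  sides-cover f {0F} {0F} k≢k′ _  _  = ⊥-elim (k≢k′ ≡.refl)
  sides-cover f {0F} {1F} _    e  e′ = trans (sym e′) (sym e) , sym e′
  sides-cover f {0F} {2F} _    e  e′ = e′ , trans e′ e
  sides-cover f {1F} {0F} _    e  e′ = trans (sym e) (sym e′) , sym e
  sides-cover f {1F} {1F} k≢k′ _  _  = ⊥-elim (k≢k′ ≡.refl)
  sides-cover f {1F} {2F} _    e  e′ = e′ , sym e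
  sides-cover f {2F} {0F} _    e  e′ = e , trans e e′
  sides-cover f {2F} {1F} _    e  e′ = e , sym e′
  sides-cover f {2F} {2F} k≢k′ _  _  = ⊥-elim (k≢k′ ≡.refl)

  Coordinates : (Fin 3 → Carrier) → Point → (Fin 3 → Point) → Set ℓ₁
  Coordinates l p T = (∑₃ l ≈ 1#) × (x p ≈ ∑₃ (λ j → l j * x (T j))) × (y p ≈ ∑₃ (λ j → l j * y (T j)))

  offset-from-weights : ∀ {z l₀ l₁ l₂ z₀ z₁ z₂} → l₀ + l₁ + l₂ ≈ 1# →
                        z ≈ l₀ * z₀ + l₁ * z₁ + l₂ * z₂ → z - z₀ ≈ l₁ * (z₁ - z₀) + l₂ * (z₂ - z₀)
  offset-from-weights {z} {l₀} {l₁} {l₂} {z₀} {z₁} {z₂} sum≈1 z≈ = begin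
    z - z₀                                           ≈⟨ +-cong z≈ (-‿cong (trans (sym (*-identityˡ z₀)) (*-congʳ (sym sum≈1)))) ⟩
    (l₀ * z₀ + l₁ * z₁ + l₂ * z₂) - (l₀ + l₁ + l₂) * z₀  ≈⟨ regroup l₀ l₁ l₂ z₀ z₁ z₂ ⟩
    l₁ * (z₁ - z₀) + l₂ * (z₂ - z₀)                  ∎
    where
    regroup : ∀ l₀ l₁ l₂ z₀ z₁ z₂ →
              (l₀ * z₀ + l₁ * z₁ + l₂ * z₂) - (l₀ + l₁ + l₂) * z₀ ≈ l₁ * (z₁ - z₀) + l₂ * (z₂ - z₀)
    regroup = solve 6 (λ l₀ l₁ l₂ z₀ z₁ z₂ →
      (l₀ :* z₀ :+ l₁ :* z₁ :+ l₂ :* z₂) :- (l₀ :+ l₁ :+ l₂) :* z₀ := l₁ :* (z₁ :- z₀) :+ l₂ :* (z₂ :- z₀)) refl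

  weights-from-offset : ∀ {z l₁ l₂ z₀ z₁ z₂} → z - z₀ ≈ l₁ * (z₁ - z₀) + l₂ * (z₂ - z₀) →
                        z ≈ (1# - l₁ - l₂) * z₀ + l₁ * z₁ + l₂ * z₂
  weights-from-offset {z} {l₁} {l₂} {z₀} {z₁} {z₂} δ = begin
    z                                              ≈⟨ x-y≈z⇒x≈y+z δ ⟩
    z₀ + (l₁ * (z₁ - z₀) + l₂ * (z₂ - z₀))         ≈⟨ +-congʳ (*-identityˡ z₀) ⟨
    1# * z₀ + (l₁ * (z₁ - z₀) + l₂ * (z₂ - z₀))    ≈⟨ regroup 1# l₁ l₂ z₀ z₁ z₂ ⟩
    (1# - l₁ - l₂) * z₀ + l₁ * z₁ + l₂ * z₂        ∎
    where
    regroup : ∀ o l₁ l₂ z₀ z₁ z₂ →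
              o * z₀ + (l₁ * (z₁ - z₀) + l₂ * (z₂ - z₀)) ≈ (o - l₁ - l₂) * z₀ + l₁ * z₁ + l₂ * z₂
    regroup = solve 6 (λ o l₁ l₂ z₀ z₁ z₂ →
      o :* z₀ :+ (l₁ :* (z₁ :- z₀) :+ l₂ :* (z₂ :- z₀)) := (o :- l₁ :- l₂) :* z₀ :+ l₁ :* z₁ :+ l₂ :* z₂) refl

  interpolate-weights : ∀ {zp zq l₀ l₁ l₂ m₀ m₁ m₂} s z₀ z₁ z₂ →
    zp ≈ l₀ * z₀ + l₁ * z₁ + l₂ * z₂ → zq ≈ m₀ * z₀ + m₁ * z₁ + m₂ * z₂ →
    zp + s * (zq - zp) ≈ (l₀ + s * (m₀ - l₀)) * z₀ + (l₁ + s * (m₁ - l₁)) * z₁ + (l₂ + s * (m₂ - l₂)) * z₂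
  interpolate-weights {l₀ = l₀} {l₁} {l₂} {m₀} {m₁} {m₂} s z₀ z₁ z₂ zp≈ zq≈ =
    trans (+-cong zp≈ (*-congˡ (+-cong zq≈ (-‿cong zp≈)))) (distribute l₀ l₁ l₂ m₀ m₁ m₂ s z₀ z₁ z₂)
    where
    distribute : ∀ l₀ l₁ l₂ m₀ m₁ m₂ s z₀ z₁ z₂ →
      (l₀ * z₀ + l₁ * z₁ + l₂ * z₂) + s * ((m₀ * z₀ + m₁ * z₁ + m₂ * z₂) - (l₀ * z₀ + l₁ * z₁ + l₂ * z₂))
      ≈ (l₀ + s * (m₀ - l₀)) * z₀ + (l₁ + s * (m₁ - l₁)) * z₁ + (l₂ + s * (m₂ - l₂)) * z₂
    distribute = solve 10 (λ l₀ l₁ l₂ m₀ m₁ m₂ s z₀ z₁ z₂ →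
      (l₀ :* z₀ :+ l₁ :* z₁ :+ l₂ :* z₂) :+ s :* ((m₀ :* z₀ :+ m₁ :* z₁ :+ m₂ :* z₂) :- (l₀ :* z₀ :+ l₁ :* z₁ :+ l₂ :* z₂))
      := (l₀ :+ s :* (m₀ :- l₀)) :* z₀ :+ (l₁ :+ s :* (m₁ :- l₁)) :* z₁ :+ (l₂ :+ s :* (m₂ :- l₂)) :* z₂) refl

  interpolate-sum : ∀ {l₀ l₁ l₂ m₀ m₁ m₂} s → l₀ + l₁ + l₂ ≈ 1# → m₀ + m₁ + m₂ ≈ 1# →
                    (l₀ + s * (m₀ - l₀)) + (l₁ + s * (m₁ - l₁)) + (l₂ + s * (m₂ - l₂)) ≈ 1#
  interpolate-sum {l₀} {l₁} {l₂} {m₀} {m₁} {m₂} s Σl≈1 Σm≈1 = begin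
    (l₀ + s * (m₀ - l₀)) + (l₁ + s * (m₁ - l₁)) + (l₂ + s * (m₂ - l₂))  ≈⟨ collect l₀ l₁ l₂ m₀ m₁ m₂ s ⟩
    (l₀ + l₁ + l₂) + s * ((m₀ + m₁ + m₂) - (l₀ + l₁ + l₂))              ≈⟨ +-cong Σl≈1 (*-congˡ (+-cong Σm≈1 (-‿cong Σl≈1))) ⟩
    1# + s * (1# - 1#)                                                  ≈⟨ +-congˡ (trans (*-congˡ (-‿inverseʳ 1#)) (zeroʳ s)) ⟩
    1# + 0#                                                             ≈⟨ +-identityʳ 1# ⟩
    1#                                                                  ∎
    where
    collect : ∀ l₀ l₁ l₂ m₀ m₁ m₂ s →
      (l₀ + s * (m₀ - l₀)) + (l₁ + s * (m₁ - l₁)) + (l₂ + s * (m₂ - l₂))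
      ≈ (l₀ + l₁ + l₂) + s * ((m₀ + m₁ + m₂) - (l₀ + l₁ + l₂))
    collect = solve 7 (λ l₀ l₁ l₂ m₀ m₁ m₂ s →
      (l₀ :+ s :* (m₀ :- l₀)) :+ (l₁ :+ s :* (m₁ :- l₁)) :+ (l₂ :+ s :* (m₂ :- l₂))
      := (l₀ :+ l₁ :+ l₂) :+ s :* ((m₀ :+ m₁ :+ m₂) :- (l₀ :+ l₁ :+ l₂))) refl

  module _ (T : Fin 3 → Point) where

    Δ : Carrier
    Δ = det (T 0F) (T 1F) (T 2F)

    interior⇒coordinates : ∀ {p} → InInterior p (T 0F) (T 1F) (T 2F) →
                           ∃[ l ] (∀ j → 0# < l j) × Coordinates l p T
    interior⇒coordinates (l₀ , l₁ , l₂ , 0<l₀ , 0<l₁ , 0<l₂ , coordinates) =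
      (l₀ ∷ l₁ ∷ l₂ ∷ []) , (λ { 0F → 0<l₀ ; 1F → 0<l₁ ; 2F → 0<l₂ }) , coordinates

    coordinates⇒closed : ∀ {l p} → (∀ j → 0# ≤ l j) → Coordinates l p T → InClosedTriangle p (T 0F) (T 1F) (T 2F)
    coordinates⇒closed {l} 0≤l coordinates = l 0F , l 1F , l 2F , 0≤l 0F , 0≤l 1F , 0≤l 2F , coordinates

    vertex∈closedTriangle : ∀ j → InClosedTriangle (T j) (T 0F) (T 1F) (T 2F)
    vertex∈closedTriangle 0F =
      1# , 0# , 0# , 0≤1 , ≤-refl , ≤-refl , trans (+-identityʳ _) (+-identityʳ _) , pick₀ _ _ _ , pick₀ _ _ _
      where
      pick₀ : ∀ a b d → a ≈ 1# * a + 0# * b + 0# * d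
      pick₀ a b d = sym (trans (+-cong (+-cong (*-identityˡ a) (zeroˡ b)) (zeroˡ d))
                               (trans (+-identityʳ _) (+-identityʳ a)))
    vertex∈closedTriangle 1F =
      0# , 1# , 0# , ≤-refl , 0≤1 , ≤-refl , trans (+-identityʳ _) (+-identityˡ _) , pick₁ _ _ _ , pick₁ _ _ _
      where
      pick₁ : ∀ a b d → b ≈ 0# * a + 1# * b + 0# * d
      pick₁ a b d = sym (trans (+-cong (+-cong (zeroˡ a) (*-identityˡ b)) (zeroˡ d))
                               (trans (+-identityʳ _) (+-identityˡ b)))
    vertex∈closedTriangle 2F =
      0# , 0# , 1# , ≤-refl , ≤-refl , 0≤1 , trans (+-congʳ (+-identityʳ 0#)) (+-identityˡ _) , pick₂ _ _ _ , pick₂ _ _ _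
      where
      pick₂ : ∀ a b d → d ≈ 0# * a + 0# * b + 1# * d
      pick₂ a b d = sym (trans (+-cong (+-cong (zeroˡ a) (zeroˡ b)) (*-identityˡ d))
                               (trans (+-congʳ (+-identityʳ 0#)) (+-identityˡ d)))

    cramer : ∀ l p → Coordinates l p T → (det (T 0F) p (T 2F) ≈ l 1F * Δ) × (det (T 0F) (T 1F) p ≈ l 2F * Δ)
    cramer l p (Σl≈1 , px , py) =
        trans (+-cong (*-congʳ δx) (-‿cong (*-congʳ δy))) (rule₁ (l 1F) (l 2F) α₁ α₂ β₁ β₂)
      , trans (+-cong (*-congˡ δy) (-‿cong (*-congˡ δx))) (rule₂ (l 1F) (l 2F) α₁ α₂ β₁ β₂)
      where
      α₁ α₂ β₁ β₂ : Carrier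
      α₁ = x (T 1F) - x (T 0F)
      α₂ = x (T 2F) - x (T 0F)
      β₁ = y (T 1F) - y (T 0F)
      β₂ = y (T 2F) - y (T 0F)
      δx : x p - x (T 0F) ≈ l 1F * α₁ + l 2F * α₂
      δx = offset-from-weights Σl≈1 px
      δy : y p - y (T 0F) ≈ l 1F * β₁ + l 2F * β₂
      δy = offset-from-weights Σl≈1 py
      rule₁ : ∀ l₁ l₂ α₁ α₂ β₁ β₂ →
              (l₁ * α₁ + l₂ * α₂) * β₂ - (l₁ * β₁ + l₂ * β₂) * α₂ ≈ l₁ * (α₁ * β₂ - β₁ * α₂)
      rule₁ = solve 6 (λ l₁ l₂ α₁ α₂ β₁ β₂ →
        (l₁ :* α₁ :+ l₂ :* α₂) :* β₂ :- (l₁ :* β₁ :+ l₂ :* β₂) :* α₂ := l₁ :* (α₁ :* β₂ :- β₁ :* α₂)) refl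
      rule₂ : ∀ l₁ l₂ α₁ α₂ β₁ β₂ →
              α₁ * (l₁ * β₁ + l₂ * β₂) - β₁ * (l₁ * α₁ + l₂ * α₂) ≈ l₂ * (α₁ * β₂ - β₁ * α₂)
      rule₂ = solve 6 (λ l₁ l₂ α₁ α₂ β₁ β₂ →
        α₁ :* (l₁ :* β₁ :+ l₂ :* β₂) :- β₁ :* (l₁ :* α₁ :+ l₂ :* α₂) := l₂ :* (α₁ :* β₂ :- β₁ :* α₂)) refl

    coordinates-exist : ¬ (Δ ≈ 0#) → ∀ p → ∃[ m ] Coordinates m p T
    coordinates-exist Δ≉0 p with inverse Δ Δ≉0
    ... | Δ⁻¹ , ΔΔ⁻¹≈1 =
      (1# - m₁ - m₂) ∷ m₁ ∷ m₂ ∷ [] , Σm≈1 , weights-from-offset δx , weights-from-offset δy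
      where
      α₁ α₂ β₁ β₂ dx dy m₁ m₂ : Carrier
      α₁ = x (T 1F) - x (T 0F)
      α₂ = x (T 2F) - x (T 0F)
      β₁ = y (T 1F) - y (T 0F)
      β₂ = y (T 2F) - y (T 0F)
      dx = x p - x (T 0F)
      dy = y p - y (T 0F)
      m₁ = det (T 0F) p (T 2F) * Δ⁻¹
      m₂ = det (T 0F) (T 1F) p * Δ⁻¹
      Σm≈1 : (1# - m₁ - m₂) + m₁ + m₂ ≈ 1#
      Σm≈1 = cancel 1# m₁ m₂
        where
        cancel : ∀ o a b → (o - a - b) + a + b ≈ o
        cancel = solve 3 (λ o a b → (o :- a :- b) :+ a :+ b := o) refl
      undo : ∀ d → d * (Δ * Δ⁻¹) ≈ d
      undo d = trans (*-congˡ ΔΔ⁻¹≈1) (*-identityʳ d)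
      δx : dx ≈ m₁ * α₁ + m₂ * α₂
      δx = sym (trans (rule dx dy α₁ α₂ β₁ β₂ Δ⁻¹) (undo dx))
        where
        rule : ∀ dx dy α₁ α₂ β₁ β₂ Δ⁻¹ →
          ((dx * β₂ - dy * α₂) * Δ⁻¹) * α₁ + ((α₁ * dy - β₁ * dx) * Δ⁻¹) * α₂ ≈ dx * ((α₁ * β₂ - β₁ * α₂) * Δ⁻¹)
        rule = solve 7 (λ dx dy α₁ α₂ β₁ β₂ Δ⁻¹ →
          ((dx :* β₂ :- dy :* α₂) :* Δ⁻¹) :* α₁ :+ ((α₁ :* dy :- β₁ :* dx) :* Δ⁻¹) :* α₂
          := dx :* ((α₁ :* β₂ :- β₁ :* α₂) :* Δ⁻¹)) refl
      δy : dy ≈ m₁ * β₁ + m₂ * β₂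
      δy = sym (trans (rule dx dy α₁ α₂ β₁ β₂ Δ⁻¹) (undo dy))
        where
        rule : ∀ dx dy α₁ α₂ β₁ β₂ Δ⁻¹ →
          ((dx * β₂ - dy * α₂) * Δ⁻¹) * β₁ + ((α₁ * dy - β₁ * dx) * Δ⁻¹) * β₂ ≈ dy * ((α₁ * β₂ - β₁ * α₂) * Δ⁻¹)
        rule = solve 7 (λ dx dy α₁ α₂ β₁ β₂ Δ⁻¹ →
          ((dx :* β₂ :- dy :* α₂) :* Δ⁻¹) :* β₁ :+ ((α₁ :* dy :- β₁ :* dx) :* Δ⁻¹) :* β₂
          := dy :* ((α₁ :* β₂ :- β₁ :* α₂) :* Δ⁻¹)) refl

    interior-not-vertex : ¬ (Δ ≈ 0#) → ∀ j → ¬ InInterior (T j) (T 0F) (T 1F) (T 2F)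
    interior-not-vertex Δ≉0 j (l₀ , l₁ , l₂ , _ , 0<l₁ , 0<l₂ , coordinates) =
      vertex j (cramer (l₀ ∷ l₁ ∷ l₂ ∷ []) (T j) coordinates)
      where
      vertex : ∀ j → (det (T 0F) (T j) (T 2F) ≈ l₁ * Δ) × (det (T 0F) (T 1F) (T j) ≈ l₂ * Δ) → ⊥
      vertex 0F (d≈l₁Δ , _) = *-nonzero (0<x⇒x≉0 0<l₁) Δ≉0 (trans (sym d≈l₁Δ) det-repeatˡ)
      vertex 1F (_ , d≈l₂Δ) = *-nonzero (0<x⇒x≉0 0<l₂) Δ≉0 (trans (sym d≈l₂Δ) det-repeatʳ)
      vertex 2F (d≈l₁Δ , _) = *-nonzero (0<x⇒x≉0 0<l₁) Δ≉0 (trans (sym d≈l₁Δ) det-repeatʳ)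

    zero-coordinate⇒onSide : ∀ {l p} k → (∀ j → 0# ≤ l j) → l k ≈ 0# → Coordinates l p T →
                             OnSegment p (T (next k)) (T (next (next k)))
    zero-coordinate⇒onSide {l} k 0≤l lₖ≈0 (Σl≈1 , px , py) =
      weights⇒onSegment (0≤l (next k)) (0≤l (next (next k)))
        (trans (sym (∑₃-without l k lₖ≈0)) Σl≈1)
        (trans px (∑₃-without (λ j → l j * x (T j)) k (trans (*-congʳ lₖ≈0) (zeroˡ _))))
        (trans py (∑₃-without (λ j → l j * y (T j)) k (trans (*-congʳ lₖ≈0) (zeroˡ _))))

    interpolate-coordinates : ∀ {l m p q} s → Coordinates l p T → Coordinates m q T →
                              Coordinates (interpolate l m s) (along p q s) T
    interpolate-coordinates s (Σl≈1 , px , py) (Σm≈1 , qx , qy) =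
        interpolate-sum s Σl≈1 Σm≈1
      , interpolate-weights s _ _ _ px qx
      , interpolate-weights s _ _ _ py qy

    segment-crosses-side : ∀ {l m p q} → (∀ j → 0# < l j) → ¬ (∀ j → 0# ≤ m j) →
      Coordinates l p T → Coordinates m q T →
      ∃[ k ] ∃[ r ] OnSegment r p q × OnSegment r (T (next k)) (T (next (next k)))
    segment-crosses-side {l} {m} {p} {q} 0<l m≱0 p-coordinates q-coordinates =
      let s , 0≤s , s≤1 , 0≤interpolant , k , interpolantₖ≈0 = interpolation-leaves-orthant l m 0<l m≱0
      in k , along p q s , along-onSegment {p} {q} {s} 0≤s s≤1 ,
         zero-coordinate⇒onSide {interpolate l m s} {along p q s} k 0≤interpolant interpolantₖ≈0
           (interpolate-coordinates {l} {m} {p} {q} s p-coordinates q-coordinates)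

    segment-leaves-triangle : ∀ {p q} → ¬ (Δ ≈ 0#) →
      InInterior p (T 0F) (T 1F) (T 2F) → Outside q (T 0F) (T 1F) (T 2F) →
      ∃[ k ] ∃[ r ] OnSegment r p q × OnSegment r (T (next k)) (T (next (next k)))
    segment-leaves-triangle {p} {q} Δ≉0 p-interior q-outside =
      let l , 0<l , p-coordinates = interior⇒coordinates p-interior
          m , q-coordinates = coordinates-exist Δ≉0 q
      in segment-crosses-side {l} {m} {p} {q} 0<l (λ 0≤m → q-outside (coordinates⇒closed 0≤m q-coordinates))
           p-coordinates q-coordinates

module ApRACDrawing {c ℓ₁ ℓ₂} (F : OrderedField c ℓ₁ ℓ₂) {n : ℕ} (G : SimpleGraph n)
  (pos : Fin n → Geometry.Point F) (drawing : Geometry.IsApRACDrawing F G pos) where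
  open OrderedField F hiding (zero; sym)
  open Geometry F
  open PlaneGeometry F
  open SimpleGraph G using (Adj; irrefl) renaming (sym to Adj-sym)
  open IsApRACDrawing drawing

  adjacent⇒distinct : ∀ {a b} → Adj a b → ¬ (a ≡ b)
  adjacent⇒distinct {a} ab a≡b = irrefl (≡.subst (Adj a) (≡.sym a≡b) ab)

  module InteriorVertex (t : Fin 3 → Fin n) (side-adjacent : ∀ k → Adj (t (next k)) (t (next (next k))))
                        (u : Fin n) (u-interior : InInterior (pos u) (pos (t 0F)) (pos (t 1F)) (pos (t 2F))) where

    T : Fin 3 → Point
    T = pos ∘ t

    U : Point
    U = pos u

    nondegenerate : ¬ (Δ T ≈ 0#)
    nondegenerate = det≉0
      (adjacent⇒distinct (side-adjacent 2F) ∘ distinct (t 0F) (t 1F))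
      (noVertexOn (t 0F) (t 1F) (t 2F) (side-adjacent 2F)
        (adjacent⇒distinct (side-adjacent 1F)) (adjacent⇒distinct (side-adjacent 0F) ∘ ≡.sym))
      (noVertexOn (t 0F) (t 2F) (t 1F) (Adj-sym (side-adjacent 1F))
        (adjacent⇒distinct (side-adjacent 2F) ∘ ≡.sym) (adjacent⇒distinct (side-adjacent 0F)))
      (noVertexOn (t 1F) (t 2F) (t 0F) (side-adjacent 0F)
        (adjacent⇒distinct (side-adjacent 2F)) (adjacent⇒distinct (side-adjacent 1F) ∘ ≡.sym))

    u≢vertex : ∀ j → ¬ (u ≡ t j)
    u≢vertex j u≡tⱼ = interior-not-vertex T nondegenerate j
      (≡.subst (λ w → InInterior (pos w) (T 0F) (T 1F) (T 2F)) u≡tⱼ u-interior)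

    outside≢vertex : ∀ {v} → Outside (pos v) (T 0F) (T 1F) (T 2F) → ∀ j → ¬ (v ≡ t j)
    outside≢vertex v-outside j v≡tⱼ = v-outside
      (≡.subst (λ w → InClosedTriangle (pos w) (T 0F) (T 1F) (T 2F)) (≡.sym v≡tⱼ) (vertex∈closedTriangle T j))

    u∉side : ∀ k → ¬ OnSegment U (T (next k)) (T (next (next k)))
    u∉side k = noVertexOn (t (next k)) (t (next (next k))) u (side-adjacent k) (u≢vertex _) (u≢vertex _)

    record SideCrossing (v : Fin n) : Set (c ⊔ ℓ₁ ⊔ ℓ₂) where
      field
        side    : Fin 3
        point   : Point
        on-edge : OnSegment point U (pos v)
        on-side : OnSegment point (T (next side)) (T (next (next side)))
        axes    : (Horizontal U (pos v) × Vertical (T (next side)) (T (next (next side)))) ⊎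
                  (Vertical U (pos v) × Horizontal (T (next side)) (T (next (next side))))

    open SideCrossing

    side-crossing : ∀ {v} → Adj u v → Outside (pos v) (T 0F) (T 1F) (T 2F) → SideCrossing v
    side-crossing {v} uv v-outside =
      let k , p , p∈uv , p∈side = segment-leaves-triangle T nondegenerate u-interior v-outside
      in record
        { side    = k
        ; point   = p
        ; on-edge = p∈uv
        ; on-side = p∈side
        ; axes    = crossings u v (t (next k)) (t (next (next k))) uv (side-adjacent k)
                      (u≢vertex _) (u≢vertex _) (outside≢vertex v-outside _) (outside≢vertex v-outside _)
                      (p , p∈uv , p∈side)
        }

    crossing≉U : ∀ {v} (χ : SideCrossing v) → ¬ (point χ ≈P U)
    crossing≉U χ p≈U = u∉side (side χ) (OnSegment-resp-≈P p≈U (on-side χ))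

    common-crossing⇒⊥ : ∀ {v w} → Adj u v → Adj u w → ¬ (v ≡ w) → (χ : SideCrossing v) →
                        OnSegment (point χ) U (pos w) → ⊥
    common-crossing⇒⊥ {v} {w} uv uw v≢w χ χ∈uw =
      [ noVertexOn u w v uw (adjacent⇒distinct uv ∘ ≡.sym) v≢w
      , noVertexOn u v w uv (adjacent⇒distinct uw ∘ ≡.sym) (v≢w ∘ ≡.sym)
      ]′ (segments-from-common-point (on-edge χ) χ∈uw (crossing≉U χ))

    HorizontalCrossing VerticalCrossing : ∀ {v} → SideCrossing v → Set ℓ₁
    HorizontalCrossing {v} χ = Horizontal U (pos v) × Vertical (T (next (side χ))) (T (next (next (side χ))))
    VerticalCrossing {v} χ = Vertical U (pos v) × Horizontal (T (next (side χ))) (T (next (next (side χ))))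

    horizontal-pair⇒⊥ : ∀ {v w} → Adj u v → Adj u w → ¬ (v ≡ w) → (χ : SideCrossing v) (ψ : SideCrossing w) →
                        HorizontalCrossing χ → HorizontalCrossing ψ → ⊥
    horizontal-pair⇒⊥ uv uw v≢w χ ψ (uv-horizontal , χ-vertical) (uw-horizontal , ψ-vertical)
      with side χ Fin.≟ side ψ
    ... | no different-sides = nondegenerate (equal-x⇒det≈0 (sides-cover (x ∘ T) different-sides χ-vertical ψ-vertical))
    ... | yes same-side = common-crossing⇒⊥ uv uw v≢w χ (OnSegment-resp-≈P ψ≈χ (on-edge ψ))
      where
      ψ≈χ : point ψ ≈P point χ
      ψ≈χ = ≈P-trans (horizontal-meets-vertical uw-horizontal ψ-vertical (on-edge ψ) (on-side ψ))
              (≈P-trans (reflexive (≡.cong (x ∘ T ∘ next) (≡.sym same-side)) , refl)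
                (≈P-sym (horizontal-meets-vertical uv-horizontal χ-vertical (on-edge χ) (on-side χ))))

    vertical-pair⇒⊥ : ∀ {v w} → Adj u v → Adj u w → ¬ (v ≡ w) → (χ : SideCrossing v) (ψ : SideCrossing w) →
                      VerticalCrossing χ → VerticalCrossing ψ → ⊥
    vertical-pair⇒⊥ uv uw v≢w χ ψ (uv-vertical , χ-horizontal) (uw-vertical , ψ-horizontal)
      with side χ Fin.≟ side ψ
    ... | no different-sides = nondegenerate (equal-y⇒det≈0 (sides-cover (y ∘ T) different-sides χ-horizontal ψ-horizontal))
    ... | yes same-side = common-crossing⇒⊥ uv uw v≢w χ (OnSegment-resp-≈P ψ≈χ (on-edge ψ))
      where
      ψ≈χ : point ψ ≈P point χ
      ψ≈χ = ≈P-trans (horizontal-meets-vertical ψ-horizontal uw-vertical (on-side ψ) (on-edge ψ))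
              (≈P-trans (refl , reflexive (≡.cong (y ∘ T ∘ next) (≡.sym same-side)))
                (≈P-sym (horizontal-meets-vertical χ-horizontal uv-vertical (on-side χ) (on-edge χ))))

    three-outside-neighbours⇒⊥ : ∀ {v₁ v₂ v₃} → Adj u v₁ → Adj u v₂ → Adj u v₃ →
      ¬ (v₁ ≡ v₂) → ¬ (v₁ ≡ v₃) → ¬ (v₂ ≡ v₃) →
      Outside (pos v₁) (T 0F) (T 1F) (T 2F) → Outside (pos v₂) (T 0F) (T 1F) (T 2F) →
      Outside (pos v₃) (T 0F) (T 1F) (T 2F) → ⊥
    three-outside-neighbours⇒⊥ {v₁} {v₂} {v₃} uv₁ uv₂ uv₃ v₁≢v₂ v₁≢v₃ v₂≢v₃
                               v₁-outside v₂-outside v₃-outside =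
      pigeonhole (axes χ₁) (axes χ₂) (axes χ₃)
      where
      χ₁ : SideCrossing v₁
      χ₁ = side-crossing uv₁ v₁-outside
      χ₂ : SideCrossing v₂
      χ₂ = side-crossing uv₂ v₂-outside
      χ₃ : SideCrossing v₃
      χ₃ = side-crossing uv₃ v₃-outside
      pigeonhole : HorizontalCrossing χ₁ ⊎ VerticalCrossing χ₁ → HorizontalCrossing χ₂ ⊎ VerticalCrossing χ₂ →
                   HorizontalCrossing χ₃ ⊎ VerticalCrossing χ₃ → ⊥
      pigeonhole (inj₁ h₁) (inj₁ h₂) _         = horizontal-pair⇒⊥ uv₁ uv₂ v₁≢v₂ χ₁ χ₂ h₁ h₂
      pigeonhole (inj₂ w₁) (inj₂ w₂) _         = vertical-pair⇒⊥ uv₁ uv₂ v₁≢v₂ χ₁ χ₂ w₁ w₂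
      pigeonhole (inj₁ h₁) (inj₂ _)  (inj₁ h₃) = horizontal-pair⇒⊥ uv₁ uv₃ v₁≢v₃ χ₁ χ₃ h₁ h₃
      pigeonhole (inj₁ _)  (inj₂ w₂) (inj₂ w₃) = vertical-pair⇒⊥ uv₂ uv₃ v₂≢v₃ χ₂ χ₃ w₂ w₃
      pigeonhole (inj₂ _)  (inj₁ h₂) (inj₁ h₃) = horizontal-pair⇒⊥ uv₂ uv₃ v₂≢v₃ χ₂ χ₃ h₂ h₃
      pigeonhole (inj₂ w₁) (inj₁ _)  (inj₂ w₃) = vertical-pair⇒⊥ uv₁ uv₃ v₁≢v₃ χ₁ χ₃ w₁ w₃

mainTheorem11 : ∀ {c ℓ₁ ℓ₂} (F : OrderedField c ℓ₁ ℓ₂) {n : ℕ} (G : SimpleGraph n)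
                  (pos : Fin n → Geometry.Point F) →
                  Geometry.IsApRACDrawing F G pos →
                  ¬ (∃[ t₁ ] ∃[ t₂ ] ∃[ t₃ ] ∃[ u ] ∃[ v₁ ] ∃[ v₂ ] ∃[ v₃ ]
                      (SimpleGraph.Adj G t₁ t₂ × SimpleGraph.Adj G t₂ t₃ × SimpleGraph.Adj G t₁ t₃ ×
                       SimpleGraph.Adj G u v₁ × SimpleGraph.Adj G u v₂ × SimpleGraph.Adj G u v₃ ×
                       ¬ (v₁ ≡ v₂) × ¬ (v₁ ≡ v₃) × ¬ (v₂ ≡ v₃) ×
                       Geometry.InInterior F (pos u) (pos t₁) (pos t₂) (pos t₃) ×
                       Geometry.Outside F (pos v₁) (pos t₁) (pos t₂) (pos t₃) ×
                       Geometry.Outside F (pos v₂) (pos t₁) (pos t₂) (pos t₃) ×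
                       Geometry.Outside F (pos v₃) (pos t₁) (pos t₂) (pos t₃)))
mainTheorem11 F {n} G pos drawing
  (t₁ , t₂ , t₃ , u , v₁ , v₂ , v₃ , t₁t₂ , t₂t₃ , t₁t₃ , uv₁ , uv₂ , uv₃ ,
   v₁≢v₂ , v₁≢v₃ , v₂≢v₃ , u-interior , v₁-outside , v₂-outside , v₃-outside) =
  InteriorVertex.three-outside-neighbours⇒⊥ t side-adjacent u u-interior
    uv₁ uv₂ uv₃ v₁≢v₂ v₁≢v₃ v₂≢v₃ v₁-outside v₂-outside v₃-outside
  where
  open ApRACDrawing F G pos drawing
  t : Fin 3 → Fin n
  t = t₁ ∷ t₂ ∷ t₃ ∷ []
  side-adjacent : ∀ k → SimpleGraph.Adj G (t (next k)) (t (next (next k)))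
  side-adjacent 0F = t₂t₃
  side-adjacent 1F = SimpleGraph.sym G t₁t₃
  side-adjacent 2F = t₁t₂
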